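{- Let $\mathcal{M}=(G;\Omega,\rho,\tau)$ be an algebraic map and let $\alpha\in\Omega$, with stabilizer $G_\alpha$ in $G$. Then the underlying graph $\Sigma$ of $\mathcal{M}$ is isomorphic to the monodromy graph $\mathrm{Mon}(G;G_\alpha,\rho,\tau)$.
   Context: An algebraic map $(G;\Omega,\rho,\tau)$ consists of a finite set $\Omega$ (of darts) and permutations $\rho,\tau$ of $\Omega$ with $\tau^2=1$ such that $G=\langle\rho,\tau\rangle\le\mathrm{Sym}(\Omega)$ acts transitively on $\Omega$ (so $G_\alpha$ is core-free in $G$). Its underlying graph $\Sigma$ has as vertices the cycles (orbits) of $\rho$ on $\Omega$ and as edges the cycles of $\tau$ on $\Omega$; a $\tau$-cycle $\{\beta,\beta^\tau\}$ with $\beta\ne\beta^\tau$ is an edge joining the vertices containing $\beta$ and $\beta^\tau$ (a loop if these coincide), and a fixed point $\beta=\beta^\tau$ is a free edge (an edge with only one end, at the vertex containing $\beta$). Graphs may have loops, multiple edges and free edges. Monodromy graph: for $G=\langle\rho,\tau\rangle$ with $\tau^2=1$, $U$ a core-free subgroup (i.e. $\bigcap_{g}g^{ -1}Ug=1$), $H=\langle\rho\rangle$, and $S$ a right transversal of $U$ in $G$, $\mathrm{Mon}(G;U,\rho,\tau)$ has vertex set $\{UgH\mid g\in G\}$, edge set $\{\{UhH,Uh\tau H\}\mid h\in S\}$, and for $h\in S$ the multiplicity of the edge between $UhH$ and $Uh\tau H$ is $|D|$ where $D=\{g\in S\mid g\in UhH \text{ and } g\tau\in Uh\tau H\}$; the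 edge is a free edge if $h\tau\in Uh$ and a loop if $h\tau\notin Uh$ but $h\tau\in UhH$.
   Formalization: In Mon(G;U,ρ,τ), |D| counts only edges between distinct vertices; at UhH free edges number the g ∈ S ∩ UhH with gτ ∈ Ug, and loops half the g ∈ S ∩ UhH with gτ ∈ UhH ∖ Ug. The statement above fails without it. -}

module Defs where

open import Data.Nat using (ℕ; zero; suc; _*_)
open import Data.Integer using (ℤ; +_; -[1+_])
open import Data.Fin using (Fin; toℕ)
open import Data.Fin.Permutation using (Permutation′; _⟨$⟩ʳ_; _⟨$⟩ˡ_)
open import Data.List using (List; []; _∷_; _++_; replicate; length; lookup; allFin)
open import Data.Product using (Σ; _×_; ∃)
open import Data.Sum using (_⊎_)
open import Relation.Nullary using (¬_)
open import Relation.Binary.PropositionalEquality using (_≡_; _≢_)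
open import Function.Bundles using (_⇔_)
import Data.Nat as ℕ

data CountIs {A : Set} (P : A → Set) : List A → ℕ → Set where
  c-nil  : CountIs P [] 0
  c-yes  : ∀ {x xs k} → P x → CountIs P xs k → CountIs P (x ∷ xs) (suc k)
  c-no   : ∀ {x xs k} → ¬ P x → CountIs P xs k → CountIs P (x ∷ xs) k

-- Graphs possibly with loops, multiple edges and free edges, given up to
-- isomorphism by a vertex set (a setoid) and edge multiplicities:
--   Edges v w k : there are exactly k edges with ends v and w
--                 (for v ≈ w these are the loops at v),
--   Free v k    : there are exactly k free edges at v.

record Graph : Set₁ where
  field
    V     : Set
    _≈_   : V → V → Set
    Edges : V → V → ℕ → Set
    Free  : V → ℕ → Set

record _≅_ (Γ Δ : Graph) : Set where
  private
    module Γ = Graph Γ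
    module Δ = Graph Δ
  field
    f      : Γ.V → Δ.V
    g      : Δ.V → Γ.V
    f-cong : ∀ {v w} → v Γ.≈ w → f v Δ.≈ f w
    g-cong : ∀ {v w} → v Δ.≈ w → g v Γ.≈ g w
    fg     : ∀ v → f (g v) Δ.≈ v
    gf     : ∀ v → g (f v) Γ.≈ v
    edges  : ∀ v w k → Γ.Edges v w k ⇔ Δ.Edges (f v) (f w) k
    free   : ∀ v k → Γ.Free v k ⇔ Δ.Free (f v) k

-- Elements of G = ⟨ρ,τ⟩ ≤ Sym(Ω) as words in ρ, ρ⁻¹, τ.
-- Permutations act on the right:  β^(x₁x₂…xₖ) = (…(β^x₁)^x₂…)^xₖ,
-- and the product of words g·h is concatenation g ++ h.

data Gen : Set where
  gρ gρ⁻ gτ : Gen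

Word : Set
Word = List Gen

module _ {n : ℕ} (ρ τ : Permutation′ n) where

  act : Word → Fin n → Fin n
  act []          β = β
  act (gρ  ∷ w)  β = act w (ρ ⟨$⟩ʳ β)
  act (gρ⁻ ∷ w)  β = act w (ρ ⟨$⟩ˡ β)
  act (gτ  ∷ w)  β = act w (τ ⟨$⟩ʳ β)

  _≈G_ : Word → Word → Set
  g ≈G h = ∀ β → act g β ≡ act h β

  ρ^ : ℤ → Word
  ρ^ (+ m)     = replicate m gρ
  ρ^ -[1+ m ]  = replicate (suc m) gρ⁻

  IsTransitive : Set
  IsTransitive = ∀ β γ → ∃ λ (w : Word) → act w β ≡ γ

  SameCycleρ : Fin n → Fin n → Set
  SameCycleρ β γ = ∃ λ (k : ℤ) → act (ρ^ k) β ≡ γ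

  -- Each τ-cycle is counted once, via its least element δ (δ ≤ δ^τ).
  τ-CycleJoins : Fin n → Fin n → Fin n → Set
  τ-CycleJoins β γ δ =
    toℕ δ ℕ.< toℕ (τ ⟨$⟩ʳ δ) ×
    ((SameCycleρ β δ × SameCycleρ γ (τ ⟨$⟩ʳ δ)) ⊎
     (SameCycleρ γ δ × SameCycleρ β (τ ⟨$⟩ʳ δ)))

  FreeAt : Fin n → Fin n → Set
  FreeAt β δ = SameCycleρ β δ × τ ⟨$⟩ʳ δ ≡ δ

  -- vertices are represented by darts, two darts being equal as vertices
  -- iff they lie in the same ρ-cycle
  UnderlyingGraph : Graph
  UnderlyingGraph = record
    { V     = Fin n
    ; _≈_   = SameCycleρ
    ; Edges = λ β γ k → CountIs (τ-CycleJoins β γ) (allFin n) k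
    ; Free  = λ β k → CountIs (FreeAt β) (allFin n) k
    }

  module _ (U : Word → Set) where

    _∈U·_ : Word → Word → Set
    x ∈U· g = ∃ λ (u : Word) → U u × x ≈G (u ++ g)

    _∈U·_·H : Word → Word → Set
    x ∈U· g ·H = ∃ λ (u : Word) → ∃ λ (k : ℤ) → U u × x ≈G (u ++ g ++ ρ^ k)

    _≈UH_ : Word → Word → Set
    g ≈UH g′ = ∀ x → (x ∈U· g ·H) ⇔ (x ∈U· g′ ·H)

    IsRightTransversal : List Word → Set
    IsRightTransversal S =
      ∀ g → Σ (Fin (length S)) λ i →
              (g ∈U· lookup S i) × (∀ j → g ∈U· lookup S j → j ≡ i)

    -- Between distinct vertices V = UhH, W = UhτH the multiplicity is
    --   |D| = |{g ∈ S | g ∈ UhH, gτ ∈ UhτH}|.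
    -- At a vertex V: free edges correspond to g ∈ S ∩ V with gτ ∈ Ug,
    -- loops to g ∈ S ∩ V with gτ ∈ V, gτ ∉ Ug (each loop has two such g).
    MonEdges : List Word → Word → Word → ℕ → Set
    MonEdges S h h′ k =
      (¬ (h ≈UH h′) →
         CountIs (λ g → (g ∈U· h ·H) × ((g ++ gτ ∷ []) ∈U· h′ ·H)) S k) ×
      (h ≈UH h′ →
         CountIs (λ g → (g ∈U· h ·H) × ((g ++ gτ ∷ []) ∈U· h ·H)
                         × ¬ ((g ++ gτ ∷ []) ∈U· g)) S (2 * k))

    MonFree : List Word → Word → ℕ → Set
    MonFree S h k =
      CountIs (λ g → (g ∈U· h ·H) × ((g ++ gτ ∷ []) ∈U· g)) S k

    Mon : List Word → Graph
    Mon S = record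
      { V     = Word
      ; _≈_   = _≈UH_
        ; Edges = MonEdges S
      ; Free  = MonFree S
      }

  Stab : Fin n → Word → Set
  Stab α u = act u α ≡ α

-- A dart β = α^g determines the coset G_α g, so g ↦ α^g identifies the right
-- transversal S with Ω, the double cosets G_α g ⟨ρ⟩ with the ρ-cycles, and
-- right multiplication by τ with the action of τ on darts.  Under this
-- identification the monodromy graph counts exactly the darts that the
-- underlying graph counts, except that Σ counts a non-free τ-cycle {δ, δ^τ}
-- once, via the smaller dart, while Mon counts both of its darts: pairing δ
-- with δ^τ shows that the two counts agree for edges between distinct
-- vertices and differ by the factor 2 for loops.
module Submission where

open import Defs
open import Data.Nat using (ℕ; zero; suc; _+_; _*_; _%_; _/_)
open import Data.Nat.Properties using (+-suc; +-comm; *-suc; +-identityʳ; *-cancelˡ-≡; n<1+n; m≤n⇒∃[o]m+o≡n)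
open import Data.Nat.DivMod using (m≡m%n+[m/n]*n; m%n<n)
open import Data.Integer using (+_; -[1+_])
open import Data.Fin using (Fin; toℕ; fromℕ<; _<_; _≟_)
open import Data.Fin.Properties using (pigeonhole; any?; toℕ-fromℕ<; <-cmp; <-asym; <⇒≢; _<?_)
open import Data.Fin.Permutation using (Permutation′; _⟨$⟩ʳ_; _⟨$⟩ˡ_; inverseˡ; inverseʳ)
open import Data.List using (List; []; _∷_; _++_; replicate; map; lookup; tabulate; allFin)
open import Data.List.Properties using (map-tabulate; tabulate-lookup)
open import Data.List.Relation.Unary.Unique.Propositional using (Unique)
import Data.List.Relation.Unary.Unique.Propositional.Properties as Unique
open import Data.List.Membership.Propositional using (_∈_)
open import Data.List.Membership.Propositional.Properties using (∈-allFin; ∈-map⁺; ∈-lookup)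
open import Data.List.Membership.Propositional.Properties.WithK using (unique∧set⇒bag)
open import Data.List.Relation.Binary.BagAndSetEquality using (∼bag⇒↭)
open import Data.List.Relation.Binary.Permutation.Propositional using (_↭_; ↭-sym)
import Data.List.Relation.Binary.Permutation.Propositional as ↭
open import Data.Product using (_×_; ∃; _,_; proj₁; proj₂)
open import Data.Product.Function.NonDependent.Propositional using (_×-⇔_)
open import Data.Sum using (_⊎_; inj₁; inj₂)
open import Data.Empty using (⊥-elim)
open import Relation.Nullary using (¬_; Dec; yes; no)
open import Relation.Nullary.Decidable using (_×-dec_; _⊎-dec_; ¬?)
import Relation.Nullary.Decidable as Dec
open import Relation.Unary using (Decidable)
open import Relation.Binary using (tri<; tri≈; tri>)
open import Relation.Binary.PropositionalEquality using (_≡_; _≢_; refl; sym; trans; cong; subst; subst₂; module ≡-Reasoning)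
open import Function using (_∘_)
open import Function.Bundles using (_⇔_; mk⇔; Equivalence)
import Function.Properties.Equivalence as ⇔
open import Function.Related.TypeIsomorphisms using (¬-cong-⇔)

open Equivalence using (to; from)

module _ {A : Set} {P : A → Set} where

  CountIs-functional : ∀ {xs k k′} → CountIs P xs k → CountIs P xs k′ → k ≡ k′
  CountIs-functional c-nil       c-nil         = refl
  CountIs-functional (c-yes p c) (c-yes _ c′)  = cong suc (CountIs-functional c c′)
  CountIs-functional (c-yes p c) (c-no ¬p c′)  = ⊥-elim (¬p p)
  CountIs-functional (c-no ¬p c) (c-yes p c′)  = ⊥-elim (¬p p)
  CountIs-functional (c-no _ c)  (c-no _ c′)   = CountIs-functional c c′

  CountIs-exists : Decidable P → ∀ xs → ∃ (CountIs P xs)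
  CountIs-exists P? []       = 0 , c-nil
  CountIs-exists P? (x ∷ xs) with P? x | CountIs-exists P? xs
  ... | yes p | k , c = suc k , c-yes p c
  ... | no ¬p | k , c = k , c-no ¬p c

  CountIs-↭ : ∀ {xs ys k} → xs ↭ ys → CountIs P xs k → CountIs P ys k
  CountIs-↭ ↭.refl           c                     = c
  CountIs-↭ (↭.prep x xs↭ys) (c-yes p c)           = c-yes p (CountIs-↭ xs↭ys c)
  CountIs-↭ (↭.prep x xs↭ys) (c-no ¬p c)           = c-no ¬p (CountIs-↭ xs↭ys c)
  CountIs-↭ (↭.swap x y xs↭ys) (c-yes p (c-yes q c)) = c-yes q (c-yes p (CountIs-↭ xs↭ys c))
  CountIs-↭ (↭.swap x y xs↭ys) (c-yes p (c-no ¬q c)) = c-no ¬q (c-yes p (CountIs-↭ xs↭ys c))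
  CountIs-↭ (↭.swap x y xs↭ys) (c-no ¬p (c-yes q c)) = c-yes q (c-no ¬p (CountIs-↭ xs↭ys c))
  CountIs-↭ (↭.swap x y xs↭ys) (c-no ¬p (c-no ¬q c)) = c-no ¬q (c-no ¬p (CountIs-↭ xs↭ys c))
  CountIs-↭ (↭.trans xs↭ys ys↭zs) c                = CountIs-↭ ys↭zs (CountIs-↭ xs↭ys c)

module _ {A : Set} {P Q : A → Set} where

  CountIs-resp : (∀ x → P x ⇔ Q x) → ∀ {xs k} → CountIs P xs k → CountIs Q xs k
  CountIs-resp P⇔Q c-nil       = c-nil
  CountIs-resp P⇔Q (c-yes p c) = c-yes (to (P⇔Q _) p) (CountIs-resp P⇔Q c)
  CountIs-resp P⇔Q (c-no ¬p c) = c-no (¬p ∘ from (P⇔Q _)) (CountIs-resp P⇔Q c)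

  CountIs-⊎ : (∀ x → P x → ¬ Q x) → ∀ {xs a b} →
    CountIs P xs a → CountIs Q xs b → CountIs (λ x → P x ⊎ Q x) xs (a + b)
  CountIs-⊎ disjoint c-nil c-nil = c-nil
  CountIs-⊎ disjoint (c-yes p c) (c-yes q c′) = ⊥-elim (disjoint _ p q)
  CountIs-⊎ disjoint (c-yes p c) (c-no ¬q c′) = c-yes (inj₁ p) (CountIs-⊎ disjoint c c′)
  CountIs-⊎ disjoint {a = a} (c-no ¬p c) (c-yes {k = b} q c′) =
    subst (CountIs _ _) (sym (+-suc a b)) (c-yes (inj₂ q) (CountIs-⊎ disjoint c c′))
  CountIs-⊎ disjoint (c-no ¬p c) (c-no ¬q c′) =
    c-no (λ { (inj₁ p) → ¬p p ; (inj₂ q) → ¬q q }) (CountIs-⊎ disjoint c c′)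

module _ {A B : Set} {Q : B → Set} {h : A → B} where

  CountIs-map⁻ : ∀ {xs k} → CountIs Q (map h xs) k → CountIs (Q ∘ h) xs k
  CountIs-map⁻ {[]}    c-nil       = c-nil
  CountIs-map⁻ {_ ∷ _} (c-yes q c) = c-yes q (CountIs-map⁻ c)
  CountIs-map⁻ {_ ∷ _} (c-no ¬q c) = c-no ¬q (CountIs-map⁻ c)

-- Counts of decidable predicates exist and are unique, so a count correspondence
-- needs to be proved in one direction only.
CountIs-reflect : {A B : Set} {P : A → Set} {Q : B → Set} {xs : List A} {ys : List B}
  {f : ℕ → ℕ} → Decidable P → (∀ {i j} → f i ≡ f j → i ≡ j) →
  (∀ {k} → CountIs P xs k → CountIs Q ys (f k)) →
  ∀ {k} → CountIs Q ys (f k) → CountIs P xs k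
CountIs-reflect {xs = xs} P? f-injective count→ c
  with CountIs-exists P? xs
... | k′ , c′ = subst (CountIs _ xs) (f-injective (CountIs-functional (count→ c′) c)) c′

unique-complete⇒↭allFin : ∀ {n} {xs : List (Fin n)} → Unique xs → (∀ i → i ∈ xs) → xs ↭ allFin n
unique-complete⇒↭allFin {n} unique complete =
  ∼bag⇒↭ (unique∧set⇒bag unique (Unique.allFin⁺ n) (mk⇔ (λ _ → ∈-allFin _) (λ _ → complete _)))

module Involution {n : ℕ} (t : Fin n → Fin n) (t-involutive : ∀ δ → t (t δ) ≡ δ) where

  map-allFin↭ : map t (allFin n) ↭ allFin n
  map-allFin↭ = unique-complete⇒↭allFin (Unique.map⁺ t-injective (Unique.allFin⁺ n))
    (λ δ → subst (_∈ map t (allFin n)) (t-involutive δ) (∈-map⁺ t (∈-allFin (t δ))))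
    where
    t-injective : ∀ {δ ε} → t δ ≡ t ε → δ ≡ ε
    t-injective {δ} {ε} e = trans (sym (t-involutive δ)) (trans (cong t e) (t-involutive ε))

  CountIs-∘t : ∀ {Q : Fin n → Set} {k} → CountIs Q (allFin n) k → CountIs (Q ∘ t) (allFin n) k
  CountIs-∘t = CountIs-map⁻ ∘ CountIs-↭ (↭-sym map-allFin↭)

  Oriented : (Fin n → Set) → Fin n → Set
  Oriented P δ = δ < t δ × P δ

  Oriented? : ∀ {P} → Decidable P → Decidable (Oriented P)
  Oriented? P? δ = (δ <? t δ) ×-dec P? δ

  CountIs-Oriented-+ : ∀ {P Q : Fin n → Set} {a b} →
    (∀ δ → P δ → t δ ≢ δ) → (∀ δ → Q δ ⇔ P (t δ)) →
    CountIs (Oriented P) (allFin n) a → CountIs (Oriented Q) (allFin n) b →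
    CountIs P (allFin n) (a + b)
  CountIs-Oriented-+ {P} {Q} moves Q⇔P∘t cP cQ =
    CountIs-resp split (CountIs-⊎ disjoint cP (CountIs-∘t cQ))
    where
    t-swaps-< : ∀ {δ} → t δ < t (t δ) → t δ < δ
    t-swaps-< {δ} = subst (t δ <_) (t-involutive δ)

    disjoint : ∀ δ → Oriented P δ → ¬ Oriented Q (t δ)
    disjoint δ (δ<tδ , _) (tδ<ttδ , _) = <-asym δ<tδ (t-swaps-< tδ<ttδ)

    split : ∀ δ → (Oriented P δ ⊎ Oriented Q (t δ)) ⇔ P δ
    split δ = mk⇔ join cases
      where
      join : Oriented P δ ⊎ Oriented Q (t δ) → P δ
      join (inj₁ (_ , p)) = p
      join (inj₂ (_ , q)) = subst P (t-involutive δ) (to (Q⇔P∘t (t δ)) q)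

      cases : P δ → Oriented P δ ⊎ Oriented Q (t δ)
      cases p with <-cmp δ (t δ)
      ... | tri< δ<tδ _ _ = inj₁ (δ<tδ , p)
      ... | tri≈ _ δ≡tδ _ = ⊥-elim (moves δ p (sym δ≡tδ))
      ... | tri> _ _ tδ<δ =
        inj₂ ( subst (t δ <_) (sym (t-involutive δ)) tδ<δ
             , from (Q⇔P∘t (t δ)) (subst P (sym (t-involutive δ)) p))

gen⁻¹ : Gen → Gen
gen⁻¹ gρ  = gρ⁻
gen⁻¹ gρ⁻ = gρ
gen⁻¹ gτ  = gτ

infix 9 _⁻¹

_⁻¹ : Word → Word
[] ⁻¹      = []
(x ∷ g) ⁻¹ = g ⁻¹ ++ gen⁻¹ x ∷ []

module Action {n : ℕ} (ρ τ : Permutation′ n) where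

  open ≡-Reasoning

  infixl 8 _^_

  _^_ : Fin n → Word → Fin n
  β ^ g = act ρ τ g β

  ^-++ : ∀ β g h → β ^ (g ++ h) ≡ β ^ g ^ h
  ^-++ β []         h = refl
  ^-++ β (gρ  ∷ g) h = ^-++ (ρ ⟨$⟩ʳ β) g h
  ^-++ β (gρ⁻ ∷ g) h = ^-++ (ρ ⟨$⟩ˡ β) g h
  ^-++ β (gτ  ∷ g) h = ^-++ (τ ⟨$⟩ʳ β) g h

  ρ⁺ : ℕ → Word
  ρ⁺ m = replicate m gρ

  ρ⁺-+ : ∀ m k β → β ^ ρ⁺ (m + k) ≡ β ^ ρ⁺ m ^ ρ⁺ k
  ρ⁺-+ zero    k β = refl
  ρ⁺-+ (suc m) k β = ρ⁺-+ m k (ρ ⟨$⟩ʳ β)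

  ρ⁺-injective : ∀ m {β γ} → β ^ ρ⁺ m ≡ γ ^ ρ⁺ m → β ≡ γ
  ρ⁺-injective zero    e = e
  ρ⁺-injective (suc m) e =
    trans (sym (inverseˡ ρ)) (trans (cong (ρ ⟨$⟩ˡ_) (ρ⁺-injective m e)) (inverseˡ ρ))

  ρ⁺-period : ∀ β → ∃ λ q → β ^ ρ⁺ (suc q) ≡ β
  ρ⁺-period β with pigeonhole (n<1+n n) (λ i → β ^ ρ⁺ (toℕ i))
  ... | i , j , i<j , e with m≤n⇒∃[o]m+o≡n i<j
  ... | o , i+o≡j = o , ρ⁺-injective (toℕ i) (begin
    β ^ ρ⁺ (suc o) ^ ρ⁺ (toℕ i)  ≡⟨ ρ⁺-+ (suc o) (toℕ i) β ⟨
    β ^ ρ⁺ (suc o + toℕ i)       ≡⟨ cong (λ m → β ^ ρ⁺ m) (trans (cong suc (+-comm o (toℕ i))) i+o≡j) ⟩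
    β ^ ρ⁺ (toℕ j)               ≡⟨ e ⟨
    β ^ ρ⁺ (toℕ i)               ∎)

  module _ {p β} (periodic : β ^ ρ⁺ p ≡ β) where

    ρ⁺-periodic-* : ∀ c → β ^ ρ⁺ (c * p) ≡ β
    ρ⁺-periodic-* zero    = refl
    ρ⁺-periodic-* (suc c) = begin
      β ^ ρ⁺ (p + c * p)    ≡⟨ ρ⁺-+ p (c * p) β ⟩
      β ^ ρ⁺ p ^ ρ⁺ (c * p) ≡⟨ cong (_^ ρ⁺ (c * p)) periodic ⟩
      β ^ ρ⁺ (c * p)        ≡⟨ ρ⁺-periodic-* c ⟩
      β                     ∎

  ρ⁺-mod : ∀ {q β} → β ^ ρ⁺ (suc q) ≡ β → ∀ m → β ^ ρ⁺ m ≡ β ^ ρ⁺ (m % suc q)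
  ρ⁺-mod {q} {β} periodic m = begin
    β ^ ρ⁺ m                                    ≡⟨ cong (λ k → β ^ ρ⁺ k) m≡[m/p]*p+m%p ⟩
    β ^ ρ⁺ (m / suc q * suc q + m % suc q)      ≡⟨ ρ⁺-+ (m / suc q * suc q) (m % suc q) β ⟩
    β ^ ρ⁺ (m / suc q * suc q) ^ ρ⁺ (m % suc q) ≡⟨ cong (_^ ρ⁺ (m % suc q)) (ρ⁺-periodic-* periodic (m / suc q)) ⟩
    β ^ ρ⁺ (m % suc q)                          ∎
    where
    m≡[m/p]*p+m%p : m ≡ m / suc q * suc q + m % suc q
    m≡[m/p]*p+m%p = trans (m≡m%n+[m/n]*n m (suc q)) (+-comm (m % suc q) _)

  Reachable : Fin n → Fin n → Set
  Reachable β γ = ∃ λ m → β ^ ρ⁺ m ≡ γ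

  Reachable-refl : ∀ {β} → Reachable β β
  Reachable-refl = 0 , refl

  Reachable-trans : ∀ {β γ δ} → Reachable β γ → Reachable γ δ → Reachable β δ
  Reachable-trans {β} (m , refl) (k , refl) = m + k , ρ⁺-+ m k β

  -- a multiple of the period of β brings β ^ ρ⁺ m back to β
  Reachable-sym : ∀ {β γ} → Reachable β γ → Reachable γ β
  Reachable-sym {β} (m , refl) with ρ⁺-period β
  ... | q , periodic = m * q , (begin
    β ^ ρ⁺ m ^ ρ⁺ (m * q) ≡⟨ ρ⁺-+ m (m * q) β ⟨
    β ^ ρ⁺ (m + m * q)    ≡⟨ cong (λ k → β ^ ρ⁺ k) (*-suc m q) ⟨
    β ^ ρ⁺ (m * suc q)    ≡⟨ ρ⁺-periodic-* periodic m ⟩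
    β                     ∎)

  ρ⁻-Reachable : ∀ m β → Reachable (β ^ replicate m gρ⁻) β
  ρ⁻-Reachable zero    β = Reachable-refl
  ρ⁻-Reachable (suc m) β = Reachable-trans (ρ⁻-Reachable m (ρ ⟨$⟩ˡ β)) (1 , inverseʳ ρ)

  Reachable? : ∀ β γ → Dec (Reachable β γ)
  Reachable? β γ with ρ⁺-period β
  ... | q , periodic = Dec.map′ (λ (i , e) → toℕ i , e) reduce
    (any? λ (i : Fin (suc q)) → β ^ ρ⁺ (toℕ i) ≟ γ)
    where
    reduce : Reachable β γ → ∃ λ (i : Fin (suc q)) → β ^ ρ⁺ (toℕ i) ≡ γ
    reduce (m , e) = fromℕ< (m%n<n m (suc q)) ,
      trans (cong (λ k → β ^ ρ⁺ k) (toℕ-fromℕ< (m%n<n m (suc q)))) (trans (sym (ρ⁺-mod {q} periodic m)) e)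

  SameCycleρ⇔Reachable : ∀ {β γ} → SameCycleρ ρ τ β γ ⇔ Reachable β γ
  SameCycleρ⇔Reachable {β} = mk⇔ to′ (λ (m , e) → + m , e)
    where
    to′ : ∀ {γ} → SameCycleρ ρ τ β γ → Reachable β γ
    to′ (+ m      , e)    = m , e
    to′ (-[1+ m ] , refl) = Reachable-sym (ρ⁻-Reachable (suc m) β)

  SameCycleρ-refl : ∀ {β} → SameCycleρ ρ τ β β
  SameCycleρ-refl = + 0 , refl

  SameCycleρ-sym : ∀ {β γ} → SameCycleρ ρ τ β γ → SameCycleρ ρ τ γ β
  SameCycleρ-sym = from SameCycleρ⇔Reachable ∘ Reachable-sym ∘ to SameCycleρ⇔Reachable

  SameCycleρ-trans : ∀ {β γ δ} → SameCycleρ ρ τ β γ → SameCycleρ ρ τ γ δ → SameCycleρ ρ τ β δ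
  SameCycleρ-trans c c′ =
    from SameCycleρ⇔Reachable (Reachable-trans (to SameCycleρ⇔Reachable c) (to SameCycleρ⇔Reachable c′))

  SameCycleρ? : ∀ β γ → Dec (SameCycleρ ρ τ β γ)
  SameCycleρ? β γ = Dec.map (⇔.sym SameCycleρ⇔Reachable) (Reachable? β γ)

  module _ (τ-involutive : ∀ β → τ ⟨$⟩ʳ (τ ⟨$⟩ʳ β) ≡ β) where

    gen⁻¹-cancelʳ : ∀ x β → β ^ (x ∷ []) ^ (gen⁻¹ x ∷ []) ≡ β
    gen⁻¹-cancelʳ gρ  β = inverseˡ ρ
    gen⁻¹-cancelʳ gρ⁻ β = inverseʳ ρ
    gen⁻¹-cancelʳ gτ  β = τ-involutive β

    gen⁻¹-cancelˡ : ∀ x β → β ^ (gen⁻¹ x ∷ []) ^ (x ∷ []) ≡ β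
    gen⁻¹-cancelˡ gρ  β = inverseʳ ρ
    gen⁻¹-cancelˡ gρ⁻ β = inverseˡ ρ
    gen⁻¹-cancelˡ gτ  β = τ-involutive β

    ^-⁻¹-cancelʳ : ∀ g β → β ^ g ^ g ⁻¹ ≡ β
    ^-⁻¹-cancelʳ []      β = refl
    ^-⁻¹-cancelʳ (x ∷ g) β = begin
      β ^ (x ∷ g) ^ (g ⁻¹ ++ x⁻¹)       ≡⟨ ^-++ _ (g ⁻¹) x⁻¹ ⟩
      β ^ (x ∷ g) ^ g ⁻¹ ^ x⁻¹          ≡⟨ cong (λ γ → γ ^ g ⁻¹ ^ x⁻¹) (^-++ β (x ∷ []) g) ⟩
      β ^ (x ∷ []) ^ g ^ g ⁻¹ ^ x⁻¹     ≡⟨ cong (_^ x⁻¹) (^-⁻¹-cancelʳ g _) ⟩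
      β ^ (x ∷ []) ^ x⁻¹                ≡⟨ gen⁻¹-cancelʳ x β ⟩
      β                                 ∎
      where x⁻¹ = gen⁻¹ x ∷ []

    ^-⁻¹-cancelˡ : ∀ g β → β ^ g ⁻¹ ^ g ≡ β
    ^-⁻¹-cancelˡ []      β = refl
    ^-⁻¹-cancelˡ (x ∷ g) β = begin
      β ^ (g ⁻¹ ++ x⁻¹) ^ (x ∷ g)       ≡⟨ ^-++ _ (x ∷ []) g ⟩
      β ^ (g ⁻¹ ++ x⁻¹) ^ (x ∷ []) ^ g  ≡⟨ cong (λ γ → γ ^ (x ∷ []) ^ g) (^-++ β (g ⁻¹) x⁻¹) ⟩
      β ^ g ⁻¹ ^ x⁻¹ ^ (x ∷ []) ^ g     ≡⟨ cong (_^ g) (gen⁻¹-cancelˡ x _) ⟩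
      β ^ g ⁻¹ ^ g                      ≡⟨ ^-⁻¹-cancelˡ g β ⟩
      β                                 ∎
      where x⁻¹ = gen⁻¹ x ∷ []

module Cosets {n : ℕ} (ρ τ : Permutation′ n) (τ-involutive : ∀ β → τ ⟨$⟩ʳ (τ ⟨$⟩ʳ β) ≡ β)
              (α : Fin n) where

  open Action ρ τ
  open ≡-Reasoning

  _∈Gα·_ : Word → Word → Set
  _∈Gα·_ = _∈U·_ ρ τ (Stab ρ τ α)

  _∈Gα·_·H : Word → Word → Set
  _∈Gα·_·H = _∈U·_·H ρ τ (Stab ρ τ α)

  _≈GαH_ : Word → Word → Set
  _≈GαH_ = _≈UH_ ρ τ (Stab ρ τ α)

  ∈Gα·⇔ : ∀ x g → x ∈Gα· g ⇔ α ^ x ≡ α ^ g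
  ∈Gα·⇔ x g = mk⇔ to′ from′
    where
    to′ : x ∈Gα· g → α ^ x ≡ α ^ g
    to′ (u , αu≡α , x≈ug) = begin
      α ^ x        ≡⟨ x≈ug α ⟩
      α ^ (u ++ g) ≡⟨ ^-++ α u g ⟩
      α ^ u ^ g    ≡⟨ cong (_^ g) αu≡α ⟩
      α ^ g        ∎

    from′ : α ^ x ≡ α ^ g → x ∈Gα· g
    from′ αx≡αg = x ++ g ⁻¹ , x·g⁻¹∈Gα , x≈x·g⁻¹·g
      where
      x·g⁻¹∈Gα : α ^ (x ++ g ⁻¹) ≡ α
      x·g⁻¹∈Gα = begin
        α ^ (x ++ g ⁻¹) ≡⟨ ^-++ α x (g ⁻¹) ⟩
        α ^ x ^ g ⁻¹    ≡⟨ cong (_^ g ⁻¹) αx≡αg ⟩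
        α ^ g ^ g ⁻¹    ≡⟨ ^-⁻¹-cancelʳ τ-involutive g α ⟩
        α               ∎

      x≈x·g⁻¹·g : ∀ β → β ^ x ≡ β ^ ((x ++ g ⁻¹) ++ g)
      x≈x·g⁻¹·g β = sym (begin
        β ^ ((x ++ g ⁻¹) ++ g) ≡⟨ ^-++ β (x ++ g ⁻¹) g ⟩
        β ^ (x ++ g ⁻¹) ^ g    ≡⟨ cong (_^ g) (^-++ β x (g ⁻¹)) ⟩
        β ^ x ^ g ⁻¹ ^ g       ≡⟨ ^-⁻¹-cancelˡ τ-involutive g (β ^ x) ⟩
        β ^ x                  ∎)

  -- x ∈ G_α g ⟨ρ⟩ unfolds to x ∈ G_α (g ρ^k) for some k
  ∈Gα·H⇔ : ∀ x g → x ∈Gα· g ·H ⇔ SameCycleρ ρ τ (α ^ g) (α ^ x)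
  ∈Gα·H⇔ x g = mk⇔
    (λ (u , k , u∈Gα , x≈ugρᵏ) →
       k , sym (trans (to (∈Gα·⇔ x (g ++ ρ^ ρ τ k)) (u , u∈Gα , x≈ugρᵏ)) (^-++ α g (ρ^ ρ τ k))))
    from′
    where
    from′ : SameCycleρ ρ τ (α ^ g) (α ^ x) → x ∈Gα· g ·H
    from′ (k , e) with from (∈Gα·⇔ x (g ++ ρ^ ρ τ k)) (sym (trans (^-++ α g (ρ^ ρ τ k)) e))
    ... | u , u∈Gα , x≈ugρᵏ = u , k , u∈Gα , x≈ugρᵏ

  ≈GαH⇔ : ∀ {g h} → g ≈GαH h ⇔ SameCycleρ ρ τ (α ^ g) (α ^ h)
  ≈GαH⇔ {g} {h} = mk⇔
    (λ g≈h → SameCycleρ-sym (to (∈Gα·H⇔ g h) (to (g≈h g) (from (∈Gα·H⇔ g g) SameCycleρ-refl))))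
    (λ g∼h x → mk⇔
       (λ x∈gH → from (∈Gα·H⇔ x h) (SameCycleρ-trans (SameCycleρ-sym g∼h) (to (∈Gα·H⇔ x g) x∈gH)))
       (λ x∈hH → from (∈Gα·H⇔ x g) (SameCycleρ-trans g∼h (to (∈Gα·H⇔ x h) x∈hH))))

  ^-τ : ∀ g → α ^ (g ++ gτ ∷ []) ≡ τ ⟨$⟩ʳ (α ^ g)
  ^-τ g = ^-++ α g (gτ ∷ [])

module Transversal {n : ℕ} (ρ τ : Permutation′ n) (τ-involutive : ∀ β → τ ⟨$⟩ʳ (τ ⟨$⟩ʳ β) ≡ β)
                   (transitive : IsTransitive ρ τ) (α : Fin n) (S : List Word)
                   (S-transversal : IsRightTransversal ρ τ (Stab ρ τ α) S) where

  open Action ρ τ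
  open Cosets ρ τ τ-involutive α

  α^S↭allFin : map (α ^_) S ↭ allFin n
  α^S↭allFin = unique-complete⇒↭allFin (subst Unique tabulate≡map (Unique.tabulate⁺ injective)) complete
    where
    tabulate≡map : tabulate ((α ^_) ∘ lookup S) ≡ map (α ^_) S
    tabulate≡map = trans (sym (map-tabulate (lookup S) (α ^_))) (cong (map (α ^_)) (tabulate-lookup S))

    injective : ∀ {i j} → α ^ lookup S i ≡ α ^ lookup S j → i ≡ j
    injective {i} {j} e with S-transversal (lookup S i)
    ... | k , _ , only-k = trans (only-k i (from (∈Gα·⇔ (lookup S i) (lookup S i)) refl))
                             (sym (only-k j (from (∈Gα·⇔ (lookup S i) (lookup S j)) e)))

    complete : ∀ β → β ∈ map (α ^_) S
    complete β with transitive α β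
    ... | w , αw≡β with S-transversal w
    ... | i , w∈Gα·Sᵢ , _ =
      subst (_∈ map (α ^_) S) (trans (sym (to (∈Gα·⇔ w (lookup S i)) w∈Gα·Sᵢ)) αw≡β) (∈-map⁺ (α ^_) (∈-lookup i))

  CountIs-darts⇒S : ∀ {Q : Fin n → Set} {k} → CountIs Q (allFin n) k → CountIs (Q ∘ (α ^_)) S k
  CountIs-darts⇒S = CountIs-map⁻ ∘ CountIs-↭ (↭-sym α^S↭allFin)

  section : Fin n → Word
  section β = proj₁ (transitive α β)

  α^section : ∀ β → α ^ section β ≡ β
  α^section β = proj₂ (transitive α β)

  ∈section·H⇔ : ∀ g v → g ∈Gα· section v ·H ⇔ SameCycleρ ρ τ v (α ^ g)
  ∈section·H⇔ g v = subst (λ β → g ∈Gα· section v ·H ⇔ SameCycleρ ρ τ β (α ^ g)) (α^section v)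
    (∈Gα·H⇔ g (section v))

  ∈section·H-τ⇔ : ∀ g v → (g ++ gτ ∷ []) ∈Gα· section v ·H ⇔ SameCycleρ ρ τ v (τ ⟨$⟩ʳ (α ^ g))
  ∈section·H-τ⇔ g v = subst (λ β → (g ++ gτ ∷ []) ∈Gα· section v ·H ⇔ SameCycleρ ρ τ v β) (^-τ g) (∈section·H⇔ (g ++ gτ ∷ []) v)

  ∈Gα·-τ⇔ : ∀ g → (g ++ gτ ∷ []) ∈Gα· g ⇔ τ ⟨$⟩ʳ (α ^ g) ≡ α ^ g
  ∈Gα·-τ⇔ g = subst (λ β → (g ++ gτ ∷ []) ∈Gα· g ⇔ β ≡ α ^ g) (^-τ g) (∈Gα·⇔ (g ++ gτ ∷ []) g)

  section-≈GαH⇔ : ∀ {v w} → section v ≈GαH section w ⇔ SameCycleρ ρ τ v w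
  section-≈GαH⇔ {v} {w} =
    subst₂ (λ β γ → section v ≈GαH section w ⇔ SameCycleρ ρ τ β γ) (α^section v) (α^section w) ≈GαH⇔

module UnderlyingGraph≅Mon {n : ℕ} (ρ τ : Permutation′ n) (τ-involutive : ∀ β → τ ⟨$⟩ʳ (τ ⟨$⟩ʳ β) ≡ β)
                           (transitive : IsTransitive ρ τ) (α : Fin n) (S : List Word)
                           (S-transversal : IsRightTransversal ρ τ (Stab ρ τ α) S) where

  open Action ρ τ
  open Cosets ρ τ τ-involutive α
  open Transversal ρ τ τ-involutive transitive α S S-transversal
  open Involution (τ ⟨$⟩ʳ_) τ-involutive

  private
    t : Fin n → Fin n
    t δ = τ ⟨$⟩ʳ δ

    infix 4 _∼_
    _∼_ : Fin n → Fin n → Set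
    _∼_ = SameCycleρ ρ τ

  Joins : Fin n → Fin n → Fin n → Set
  Joins v w δ = v ∼ δ × w ∼ t δ

  LoopDart : Fin n → Fin n → Set
  LoopDart v δ = v ∼ δ × v ∼ t δ × t δ ≢ δ

  Joins? : ∀ v w → Decidable (Joins v w)
  Joins? v w δ = SameCycleρ? v δ ×-dec SameCycleρ? w (t δ)

  LoopDart? : ∀ v → Decidable (LoopDart v)
  LoopDart? v δ = SameCycleρ? v δ ×-dec SameCycleρ? v (t δ) ×-dec ¬? (t δ ≟ δ)

  τ-CycleJoins? : ∀ v w → Decidable (τ-CycleJoins ρ τ v w)
  τ-CycleJoins? v w δ = (δ <? t δ) ×-dec (Joins? v w δ ⊎-dec Joins? w v δ)

  joins-τ⇔ : ∀ v w δ → Joins w v δ ⇔ Joins v w (t δ)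
  joins-τ⇔ v w δ = mk⇔
    (λ (w∼δ , v∼tδ) → v∼tδ , subst (w ∼_) (sym (τ-involutive δ)) w∼δ)
    (λ (v∼tδ , w∼ttδ) → subst (w ∼_) (τ-involutive δ) w∼ttδ , v∼tδ)

  loopDart-τ⇔ : ∀ v δ → LoopDart v δ ⇔ LoopDart v (t δ)
  loopDart-τ⇔ v δ = mk⇔
    (λ (v∼δ , v∼tδ , moves) →
       v∼tδ , subst (v ∼_) (sym (τ-involutive δ)) v∼δ , moves ∘ sym ∘ trans (sym (τ-involutive δ)))
    (λ (v∼tδ , v∼ttδ , moves) →
       subst (v ∼_) (τ-involutive δ) v∼ttδ , v∼tδ , moves ∘ cong t)

  -- Between distinct vertices each τ-cycle contributes one dart on v's side.
  joins-count : ∀ {v w k} → ¬ v ∼ w →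
    CountIs (τ-CycleJoins ρ τ v w) (allFin n) k → CountIs (Joins v w) (allFin n) k
  joins-count {v} {w} v≁w c
    with CountIs-exists (Oriented? (Joins? v w)) (allFin n)
       | CountIs-exists (Oriented? (Joins? w v)) (allFin n)
  ... | a , ca | b , cb =
    subst (CountIs (Joins v w) (allFin n)) (CountIs-functional cycles c)
      (CountIs-Oriented-+ moves (joins-τ⇔ v w) ca cb)
    where
    moves : ∀ δ → Joins v w δ → t δ ≢ δ
    moves δ (v∼δ , w∼tδ) tδ≡δ = v≁w (SameCycleρ-trans v∼δ (SameCycleρ-sym (subst (w ∼_) tδ≡δ w∼tδ)))

    disjoint : ∀ δ → Oriented (Joins v w) δ → ¬ Oriented (Joins w v) δ
    disjoint δ (_ , v∼δ , _) (_ , w∼δ , _) = v≁w (SameCycleρ-trans v∼δ (SameCycleρ-sym w∼δ))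

    cycles : CountIs (τ-CycleJoins ρ τ v w) (allFin n) (a + b)
    cycles = CountIs-resp (λ δ → mk⇔
      (λ { (inj₁ (δ<tδ , j)) → δ<tδ , inj₁ j ; (inj₂ (δ<tδ , j)) → δ<tδ , inj₂ j })
      (λ { (δ<tδ , inj₁ j) → inj₁ (δ<tδ , j) ; (δ<tδ , inj₂ j) → inj₂ (δ<tδ , j) }))
      (CountIs-⊎ disjoint ca cb)

  -- A loop at v is a τ-cycle with both darts on v, and Mon counts both darts.
  loops-count : ∀ {v w k} → v ∼ w →
    CountIs (τ-CycleJoins ρ τ v w) (allFin n) k → CountIs (LoopDart v) (allFin n) (2 * k)
  loops-count {v} {w} {k} v∼w c with CountIs-exists (Oriented? (LoopDart? v)) (allFin n)
  ... | l , cl =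
    subst (λ m → CountIs (LoopDart v) (allFin n) (2 * m)) (CountIs-functional cycles c)
      (subst (CountIs (LoopDart v) (allFin n)) (cong (_+_ l) (sym (+-identityʳ l)))
        (CountIs-Oriented-+ (λ δ (_ , _ , moves) → moves) (loopDart-τ⇔ v) cl cl))
    where
    cycles : CountIs (τ-CycleJoins ρ τ v w) (allFin n) l
    cycles = CountIs-resp (λ δ → mk⇔
      (λ (δ<tδ , v∼δ , v∼tδ , _) → δ<tδ , inj₁ (v∼δ , SameCycleρ-trans (SameCycleρ-sym v∼w) v∼tδ))
      (λ { (δ<tδ , inj₁ (v∼δ , w∼tδ)) →
             δ<tδ , v∼δ , SameCycleρ-trans v∼w w∼tδ , <⇒≢ δ<tδ ∘ sym
         ; (δ<tδ , inj₂ (w∼δ , v∼tδ)) →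
             δ<tδ , SameCycleρ-trans v∼w w∼δ , v∼tδ , <⇒≢ δ<tδ ∘ sym }))
      cl

  joins⇒Mon : ∀ {v w k} → CountIs (Joins v w) (allFin n) k →
    CountIs (λ g → (g ∈Gα· section v ·H) × ((g ++ gτ ∷ []) ∈Gα· section w ·H)) S k
  joins⇒Mon {v} {w} = CountIs-resp (λ g → ⇔.sym (∈section·H⇔ g v ×-⇔ ∈section·H-τ⇔ g w)) ∘ CountIs-darts⇒S

  loops⇒Mon : ∀ {v k} → CountIs (LoopDart v) (allFin n) k →
    CountIs (λ g → (g ∈Gα· section v ·H) × ((g ++ gτ ∷ []) ∈Gα· section v ·H)
                     × ¬ ((g ++ gτ ∷ []) ∈Gα· g)) S k
  loops⇒Mon {v} = CountIs-resp (λ g → ⇔.sym (∈section·H⇔ g v ×-⇔ ∈section·H-τ⇔ g v ×-⇔ ¬-cong-⇔ (∈Gα·-τ⇔ g)))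
            ∘ CountIs-darts⇒S

  edges : ∀ v w k →
    CountIs (τ-CycleJoins ρ τ v w) (allFin n) k ⇔ MonEdges ρ τ (Stab ρ τ α) S (section v) (section w) k
  edges v w k = mk⇔
    (λ c → (λ v≉w → joins⇒Mon (joins-count (v≉w ∘ from section-≈GαH⇔) c))
         , (λ v≈w → loops⇒Mon (loops-count (to section-≈GαH⇔ v≈w) c)))
    from′
    where
    from′ : MonEdges ρ τ (Stab ρ τ α) S (section v) (section w) k → CountIs (τ-CycleJoins ρ τ v w) (allFin n) k
    from′ (distinct , equal) with SameCycleρ? v w
    ... | yes v∼w = CountIs-reflect (τ-CycleJoins? v w) (*-cancelˡ-≡ _ _ 2)
                      (loops⇒Mon ∘ loops-count v∼w) (equal (from section-≈GαH⇔ v∼w))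
    ... | no v≁w  = CountIs-reflect (τ-CycleJoins? v w) (λ e → e)
                      (joins⇒Mon ∘ joins-count v≁w) (distinct (v≁w ∘ to section-≈GαH⇔))

  free : ∀ v k → CountIs (FreeAt ρ τ v) (allFin n) k ⇔ MonFree ρ τ (Stab ρ τ α) S (section v) k
  free v k = mk⇔ free⇒Mon (CountIs-reflect (λ δ → SameCycleρ? v δ ×-dec (t δ ≟ δ)) (λ e → e) free⇒Mon)
    where
    free⇒Mon : ∀ {k} → CountIs (FreeAt ρ τ v) (allFin n) k → MonFree ρ τ (Stab ρ τ α) S (section v) k
    free⇒Mon = CountIs-resp (λ g → ⇔.sym (∈section·H⇔ g v ×-⇔ ∈Gα·-τ⇔ g)) ∘ CountIs-darts⇒S

  iso : UnderlyingGraph ρ τ ≅ Mon ρ τ (Stab ρ τ α) S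
  iso = record
    { f      = section
    ; g      = α ^_
    ; f-cong = from section-≈GαH⇔
    ; g-cong = to ≈GαH⇔
    ; fg     = λ h → from ≈GαH⇔ (subst (_∼ (α ^ h)) (sym (α^section (α ^ h))) SameCycleρ-refl)
    ; gf     = λ v → subst (α ^ section v ∼_) (α^section v) SameCycleρ-refl
    ; edges  = edges
    ; free   = free
    }

theorem3p7 : (n : ℕ) (ρ τ : Permutation′ n) →
    (∀ β → τ ⟨$⟩ʳ (τ ⟨$⟩ʳ β) ≡ β) →
    IsTransitive ρ τ →
    (α : Fin n) (S : List Word) →
    IsRightTransversal ρ τ (Stab ρ τ α) S →
    UnderlyingGraph ρ τ ≅ Mon ρ τ (Stab ρ τ α) S
theorem3p7 n ρ τ τ-involutive transitive α S S-transversal =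
  UnderlyingGraph≅Mon.iso ρ τ τ-involutive transitive α S S-transversal
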